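{- Suppose $(\mathsf P,\mathsf{Opens})$ is a semitopology and $p\in\mathsf P$. Then the following are equivalent: \begin{itemize} \item $p$ is regular. \item $p$ is weakly regular and unconflicted. \end{itemize} More succinctly: regular = weakly regular + unconflicted.
   Context: A semitopology is a pair $(\mathsf P,\mathsf{Opens})$ with $\mathsf{Opens}\subseteq\mathcal P(\mathsf P)$ containing $\varnothing$ and $\mathsf P$ and closed under arbitrary unions. Points $p,p'$ are intertwined when every open neighbourhood of $p$ intersects every open neighbourhood of $p'$; $p_{\between}$ denotes the set of points intertwined with $p$. $\mathrm{interior}(X)$ is the union of open sets contained in $X$. The community of $p$ is $K(p)=\mathrm{interior}(p_{\between})$. $p$ is regular when $p\in K(p)$ and $K(p)$ is nonempty, open and transitive (for all open $O,O'$, if $O\cap K(p)\neq\varnothing$ and $K(p)\cap O'\neq\varnothing$ then $O\cap O'\neq\varnothing$); weakly regular when $p\in K(p)$. $p$ is unconflicted when whenever $p'$ is intertwined with $p$ and $p$ is intertwined with $p''$, also $p'$ is intertwined with $p''$. -}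

module Defs where

open import Data.Product using (Σ; ∃; _×_; _,_; proj₁; proj₂)
open import Data.Empty using (⊥)
open import Relation.Nullary using (¬_)
open import Function.Bundles using (_⇔_)

-- A semitopology on a carrier P.  The set Opens ⊆ 𝒫(P) is presented as an
-- index type Open together with a membership relation _∈_ (each o : Open
-- determines the subset {x | x ∈ o}).
record Semitopology : Set₁ where
  infix 4 _∈_
  field
    P       : Set
    Open    : Set
    _∈_     : P → Open → Set
    empty   : Open
    empty-∅ : ∀ x → ¬ (x ∈ empty)
    full    : Open
    full-P  : ∀ x → x ∈ full
    ⋃       : {I : Set} → (I → Open) → Open
    ⋃-spec  : {I : Set} (f : I → Open) (x : P) → (x ∈ ⋃ f) ⇔ (∃ λ i → x ∈ f i)

module _ (S : Semitopology) where
  open Semitopology S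

  Subset : Set₁
  Subset = P → Set

  IsOpen : Subset → Set
  IsOpen X = ∃ λ (o : Open) → ∀ x → (x ∈ o) ⇔ X x

  Meets : Open → Open → Set
  Meets O O' = ∃ λ x → x ∈ O × x ∈ O'

  MeetsSet : Open → Subset → Set
  MeetsSet O X = ∃ λ x → x ∈ O × X x

  Intertwined : P → P → Set
  Intertwined p p' = ∀ (O O' : Open) → p ∈ O → p' ∈ O' → Meets O O'

  intertwinedSet : P → Subset
  intertwinedSet p = λ p' → Intertwined p p'

  interior : Subset → Subset
  interior X = λ x → ∃ λ (o : Open) → (∀ y → y ∈ o → X y) × x ∈ o

  K : P → Subset
  K p = interior (intertwinedSet p)

  Nonempty : Subset → Set
  Nonempty X = ∃ λ x → X x

  Transitive : Subset → Set
  Transitive T = ∀ (O O' : Open) → MeetsSet O T → MeetsSet O' T → Meets O O'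

  Regular : P → Set
  Regular p = K p p × Nonempty (K p) × IsOpen (K p) × Transitive (K p)

  WeaklyRegular : P → Set
  WeaklyRegular p = K p p

  Unconflicted : P → Set
  Unconflicted p = ∀ p' p'' → Intertwined p' p → Intertwined p p'' → Intertwined p' p''

-- Nonemptiness is witnessed by p and openness holds for every
-- interior.  Transitivity is where unconflictedness enters: it makes all of
-- p_≬ transitive, hence also K(p) ⊆ p_≬.  Conversely, an open neighbourhood of
-- p inside the transitive K(p) is met by the neighbourhoods of any two points
-- intertwined with p, so these are intertwined with each other.
module Submission where

open import Defs
open import Data.Product using (_×_; _,_; proj₁)
open import Function.Bundles using (_⇔_; mk⇔; Equivalence)

module _ (S : Semitopology) where
  open Semitopology S

  _⊆_ : Subset S → Subset S → Set
  X ⊆ Y = ∀ x → X x → Y x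

  intertwined-sym : ∀ {p q} → Intertwined S p q → Intertwined S q p
  intertwined-sym p≬q O O' q∈O p∈O' with p≬q O' O p∈O' q∈O
  ... | x , x∈O' , x∈O = x , x∈O , x∈O'

  interior⊆ : (X : Subset S) → interior S X ⊆ X
  interior⊆ X x (o , o⊆X , x∈o) = o⊆X x x∈o

  interior⊆interior² : (X : Subset S) → interior S X ⊆ interior S (interior S X)
  interior⊆interior² X x (o , o⊆X , x∈o) = o , (λ y y∈o → o , o⊆X , y∈o) , x∈o

  -- The union of all opens contained in X, indexed by those opens themselves.
  interior-isOpen : (X : Subset S) → IsOpen S (interior S X)
  interior-isOpen X = ⋃ proj₁ , λ x → mk⇔
    (λ x∈⋃ → let ((o , o⊆X) , x∈o) = Equivalence.to (⋃-spec proj₁ x) x∈⋃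
             in o , o⊆X , x∈o)
    (λ { (o , o⊆X , x∈o) → Equivalence.from (⋃-spec proj₁ x) ((o , o⊆X) , x∈o) })

  transitive-⊆ : {X T : Subset S} → X ⊆ T → Transitive S T → Transitive S X
  transitive-⊆ X⊆T trT O O' (x , x∈O , Xx) (y , y∈O' , Xy) =
    trT O O' (x , x∈O , X⊆T x Xx) (y , y∈O' , X⊆T y Xy)

  interior-transitive⇒unconflicted :
    {T : Subset S} {p : P} → Transitive S T → interior S T p → Unconflicted S p
  interior-transitive⇒unconflicted trT (o , o⊆T , p∈o) p' p'' p'≬p p≬p'' O O' p'∈O p''∈O'
    with p'≬p O o p'∈O p∈o | p≬p'' o O' p∈o p''∈O'
  ... | x , x∈O , x∈o | y , y∈o , y∈O' =
    trT O O' (x , x∈O , o⊆T x x∈o) (y , y∈O' , o⊆T y y∈o)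

  unconflicted⇒transitive-intertwinedSet :
    {p : P} → Unconflicted S p → Transitive S (intertwinedSet S p)
  unconflicted⇒transitive-intertwinedSet unc O O' (x , x∈O , p≬x) (y , y∈O' , p≬y) =
    unc x y (intertwined-sym p≬x) p≬y O O' x∈O y∈O'

theorem6p6 : (S : Semitopology) (p : Semitopology.P S) →
    Regular S p ⇔ (WeaklyRegular S p × Unconflicted S p)
theorem6p6 S p = mk⇔ regular⇒ ⇒regular
  where
  regular⇒ : Regular S p → WeaklyRegular S p × Unconflicted S p
  regular⇒ (p∈Kp , _ , _ , trK) =
    p∈Kp , interior-transitive⇒unconflicted S trK
             (interior⊆interior² S (intertwinedSet S p) p p∈Kp)

  ⇒regular : WeaklyRegular S p × Unconflicted S p → Regular S p
  ⇒regular (p∈Kp , unc) =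
    p∈Kp , (p , p∈Kp) , interior-isOpen S (intertwinedSet S p) ,
    transitive-⊆ S (interior⊆ S (intertwinedSet S p))
      (unconflicted⇒transitive-intertwinedSet S unc)
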